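{- Let $\psi$ be an invertible linear operator on $\mathbb K[x]$ that maps every polynomial of degree exactly $n$ to a polynomial of degree exactly $n$ (for all $n$), and which is unitary, i.e. the coefficient of $x^n$ in $\psi x^n$ is $1$ for all $n$. Then for all $n,k,p\in\mathbb N$, \[ \sum_{\ell=0}^p\binom{p}{\ell}(-1)^{p-\ell}\left[{n\atop k}\right]_{\psi^\ell}=\left[{n\atop k}\right]_{(\psi-1)^p}=\sum_{k=j_0<j_1<\cdots<j_p=n}\ \prod_{i=0}^{p-1}\left[{j_{i+1}\atop j_i}\right]_\psi, \] and if $p>n-k$ this quantity equals $0$.
   Context: $\mathbb K$ is a field of characteristic zero. For an operator $U$ on $\mathbb K[x]$, $\left[{n\atop k}\right]_U$ denotes the coefficient of $x^k$ in $Ux^n$. $1$ is the identity operator and powers are compositions. The rightmost sum runs over strictly increasing integer sequences $j_0<\dots<j_p$ with $j_0=k$, $j_p=n$ (for $p=0$ it is $1$ if $k=n$ and $0$ otherwise). -}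

module Defs where

open import Level using (_⊔_)
open import Algebra.Bundles using (CommutativeRing)
open import Data.Nat as ℕ using (ℕ; zero; suc; _∸_)
open import Data.Nat.Combinatorics using (_C_)
open import Data.List using (List; []; _∷_; _++_; map; replicate; upTo; concatMap; foldr)
open import Data.Product using (Σ; _×_)
open import Relation.Nullary using (¬_; yes; no)

-- Everything is parametrised by a commutative ring R (the field 𝕂 is a
-- commutative ring satisfying IsField and CharZero below).
module Poly {c ℓ} (R : CommutativeRing c ℓ) where
  open CommutativeRing R

  record IsField : Set (c ⊔ ℓ) where
    field
      nontrivial : ¬ (1# ≈ 0#)
      inverse    : ∀ x → ¬ (x ≈ 0#) → Σ Carrier (λ y → (x * y) ≈ 1#)

  _•_ : ℕ → Carrier → Carrier
  zero  • x = 0#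
  suc n • x = x + (n • x)

  CharZero : Set ℓ
  CharZero = ∀ m → ¬ ((suc m • 1#) ≈ 0#)

  _^^_ : Carrier → ℕ → Carrier
  x ^^ zero  = 1#
  x ^^ suc n = x * (x ^^ n)

  sumL : List Carrier → Carrier
  sumL = foldr _+_ 0#

  -- Polynomials in 𝕂[x]: coefficient lists, constant term first
  -- (trailing zeros allowed; polynomials are compared via coeff).
  Pol : Set c
  Pol = List Carrier

  coeff : Pol → ℕ → Carrier
  coeff []      _       = 0#
  coeff (a ∷ p) zero    = a
  coeff (a ∷ p) (suc i) = coeff p i

  _⊕_ : Pol → Pol → Pol
  []      ⊕ q       = q
  (a ∷ p) ⊕ []      = a ∷ p
  (a ∷ p) ⊕ (b ∷ q) = (a + b) ∷ (p ⊕ q)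

  scale : Carrier → Pol → Pol
  scale a = map (a *_)

  negP : Pol → Pol
  negP = map (-_)

  xpow : ℕ → Pol
  xpow n = replicate n 0# ++ (1# ∷ [])

  DegExactly : ℕ → Pol → Set ℓ
  DegExactly d p = (¬ (coeff p d ≈ 0#)) × (∀ k → d ℕ.< k → coeff p k ≈ 0#)

  -- Linear operators on 𝕂[x], determined by the images U x^n of the basis.
  Op : Set c
  Op = ℕ → Pol

  applyFrom : Op → ℕ → Pol → Pol
  applyFrom U i []      = []
  applyFrom U i (a ∷ p) = scale a (U i) ⊕ applyFrom U (suc i) p

  apply : Op → Pol → Pol
  apply U = applyFrom U 0

  idOp : Op
  idOp = xpow

  _∘ₒ_ : Op → Op → Op
  (U ∘ₒ V) n = apply U (V n)

  _-ₒ_ : Op → Op → Op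
  (U -ₒ V) n = U n ⊕ negP (V n)

  _^ₒ_ : Op → ℕ → Op
  U ^ₒ zero  = idOp
  U ^ₒ suc l = U ∘ₒ (U ^ₒ l)

  _≃ₒ_ : Op → Op → Set ℓ
  U ≃ₒ V = ∀ n k → coeff (U n) k ≈ coeff (V n) k

  Invertible : Op → Set (c ⊔ ℓ)
  Invertible U = Σ Op (λ V → ((U ∘ₒ V) ≃ₒ idOp) × ((V ∘ₒ U) ≃ₒ idOp))

  DegreePreserving : Op → Set (c ⊔ ℓ)
  DegreePreserving U = ∀ n (p : Pol) → DegExactly n p → DegExactly n (apply U p)

  -- [n k]_U = coefficient of x^k in U x^n
  bracket : Op → ℕ → ℕ → Carrier
  bracket U n k = coeff (apply U (xpow n)) k

  Unitary : Op → Set ℓ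
  Unitary U = ∀ n → bracket U n n ≈ 1#

  binomSum : Op → ℕ → ℕ → ℕ → Carrier
  binomSum ψ n k p =
    sumL (map (λ l → (p C l) • (((- 1#) ^^ (p ∸ l)) * bracket (ψ ^ₒ l) n k))
              (upTo (suc p)))

  -- all strictly increasing integer sequences k = j_0 < j_1 < ... < j_p = n
  -- (as lists of length p+1); j_{i+1} ranges over k+1, ..., n.
  chains : ℕ → ℕ → ℕ → List (List ℕ)
  chains zero    k n with k ℕ.≟ n
  ... | yes _ = (k ∷ []) ∷ []
  ... | no  _ = []
  chains (suc p) k n =
    concatMap (λ j → map (k ∷_) (chains p j n))
              (map (λ i → suc k ℕ.+ i) (upTo (n ∸ k)))

  chainProd : Op → List ℕ → Carrier
  chainProd U (a ∷ b ∷ r) = bracket U b a * chainProd U (b ∷ r)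
  chainProd U _           = 1#

  chainSum : Op → ℕ → ℕ → ℕ → Carrier
  chainSum ψ n k p = sumL (map (chainProd ψ) (chains p k n))

{-# OPTIONS --safe #-}
module Submission where

-- Since ψ preserves degrees, ψ, ψ - 1 and all their powers are lower triangular in the basis
-- (xⁿ), so coefficients of composites are finite matrix products:
-- [n k]_{U ∘ V} = Σ_{j ≤ n} [n j]_V [j k]_U.  By induction on p, [n k]_{(ψ-1)^p} = A_p Y for
-- Y_l = [n k]_{ψ^l} and A_p Y = Σ_l C(p,l) (-1)^{p-l} Y_l: expanding (ψ - 1)^{p+1} as
-- ψ (ψ - 1)^p - (ψ - 1)^p gives A_p (l ↦ Y_{l+1} - Y_l), which is A_{p+1} Y by Pascal's rule.
-- Since ψ is unitary, ψ - 1 is strictly lower triangular, so in (ψ - 1)^{p+1} = (ψ - 1)(ψ - 1)^p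
-- only the indices k < j ≤ n contribute; unfolding this recursion gives the sum over chains
-- k = j₀ < j₁ < … < j_p = n, of which there are none when p > n - k.

open import Defs
open import Algebra.Bundles using (CommutativeRing)
open import Data.Nat as ℕ using (ℕ; zero; suc; _∸_; _≤_; _<_; z≤n; s≤s)
import Data.Nat.Properties as ℕₚ
open import Data.Nat.Combinatorics using (_C_; nCk+nC[k+1]≡[n+1]C[k+1]; k>n⇒nCk≡0)
open import Data.Fin using (Fin; toℕ)
open import Data.Fin.Properties using (toℕ-inject₁; toℕ-fromℕ; toℕ≤pred[n])
open import Data.List using (List; []; _∷_; _++_; map; upTo; applyUpTo; concatMap; length)
open import Data.List.Properties using (map-++; map-∘; map-concatMap; concatMap-map)
open import Data.Product using (_×_; Σ-syntax; _,_; proj₂)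
open import Data.Sum using (_⊎_; inj₁; inj₂)
open import Data.Empty using (⊥-elim)
open import Function using (_∘_)
open import Relation.Nullary using (¬_; yes; no)
open import Relation.Binary.PropositionalEquality as P using (_≡_; _≢_)

concatMap-≡[] : ∀ {A B : Set} (f : A → List B) → (∀ x → f x ≡ []) → ∀ xs → concatMap f xs ≡ []
concatMap-≡[] f f≡[] []       = P.refl
concatMap-≡[] f f≡[] (x ∷ xs) =
  P.trans (P.cong (_++ concatMap f xs) (f≡[] x)) (concatMap-≡[] f f≡[] xs)

module _ {r ℓ} (R : CommutativeRing r ℓ) where
  open CommutativeRing R hiding (zero)
  open Poly R

  open import Algebra.Properties.Ring ring
    using (-1*x≈-x; x[y-z]≈xy-xz; [y-z]x≈yx-zx; -‿distribˡ-*; -‿+-comm; -0#≈0#)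
  open import Algebra.Properties.CommutativeSemigroup +-commutativeSemigroup
    using (interchange; x∙yz≈y∙xz)
  open import Algebra.Properties.Semiring.Sum semiring
    using (sum; sum-syntax; sum⁺-syntax; sum-cong-≋; sum-cong-≗; sum-replicate-zero; sum-init-last;
           ∑-comm; ∑-distrib-+; *-distribˡ-sum; *-distribʳ-sum)
  open import Algebra.Properties.Semiring.Mult semiring
    using (×-homo-+; ×-assoc-*; ×-comm-*) renaming (_×_ to _×′_)
  open import Relation.Binary.Reasoning.Setoid setoid

  ∑-≈0 : ∀ {m} {f : Fin m → Carrier} → (∀ i → f i ≈ 0#) → sum f ≈ 0#
  ∑-≈0 {m} f≈0 = trans (sum-cong-≋ {m} f≈0) (sum-replicate-zero m)

  ∑-neg : ∀ {m} (f : Fin m → Carrier) → ∑[ i < m ] (- f i) ≈ - sum f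
  ∑-neg {m} f = begin
    ∑[ i < m ] (- f i)       ≈⟨ sum-cong-≋ {m} (λ i → sym (-1*x≈-x (f i))) ⟩
    ∑[ i < m ] (- 1# * f i)  ≈⟨ sym (*-distribˡ-sum (- 1#) f) ⟩
    - 1# * sum f             ≈⟨ -1*x≈-x (sum f) ⟩
    - sum f                  ∎

  ∑-distrib-- : ∀ {m} (f g : Fin m → Carrier) → ∑[ i < m ] (f i - g i) ≈ sum f - sum g
  ∑-distrib-- f g = trans (∑-distrib-+ f (λ i → - g i)) (+-cong refl (∑-neg g))

  ∑-dropLeadingZeros : ∀ s m (f : ℕ → Carrier) → (∀ j → j < s → f j ≈ 0#) →
    ∑[ j < m ] f (toℕ j) ≈ ∑[ i < m ∸ s ] f (s ℕ.+ toℕ i)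
  ∑-dropLeadingZeros zero    m       f _   = refl
  ∑-dropLeadingZeros (suc s) zero    f _   = refl
  ∑-dropLeadingZeros (suc s) (suc m) f f≈0 = begin
    f 0 + ∑[ j < m ] f (suc (toℕ j))
      ≈⟨ +-cong (f≈0 0 (s≤s z≤n)) (∑-dropLeadingZeros s m (f ∘ suc) (λ j j<s → f≈0 (suc j) (s≤s j<s))) ⟩
    0# + ∑[ i < m ∸ s ] f (suc s ℕ.+ toℕ i)
      ≈⟨ +-identityˡ _ ⟩
    ∑[ i < m ∸ s ] f (suc s ℕ.+ toℕ i) ∎

  ∑≤-last : ∀ n (f : ℕ → Carrier) → ∑[ i ≤ suc n ] f (toℕ i) ≈ ∑[ i ≤ n ] f (toℕ i) + f (suc n)
  ∑≤-last n f = trans (sum-init-last {suc n} (f ∘ toℕ))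
    (+-cong (sum-cong-≋ {suc n} (λ i → reflexive (P.cong f (toℕ-inject₁ i))))
            (reflexive (P.cong f (toℕ-fromℕ (suc n)))))

  ∑∑-*-assoc : ∀ {m N} (w : Fin m → Carrier) (Y : Fin m → Fin N → Carrier) (z : Fin N → Carrier) →
    ∑[ j < N ] (∑[ l < m ] (w l * Y l j) * z j) ≈ ∑[ l < m ] (w l * ∑[ j < N ] (Y l j * z j))
  ∑∑-*-assoc {m} {N} w Y z = begin
    ∑[ j < N ] (∑[ l < m ] (w l * Y l j) * z j)
      ≈⟨ sum-cong-≋ {N} (λ j → *-distribʳ-sum (z j) (λ l → w l * Y l j)) ⟩
    ∑[ j < N ] ∑[ l < m ] ((w l * Y l j) * z j)
      ≈⟨ ∑-comm (λ j l → (w l * Y l j) * z j) ⟩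
    ∑[ l < m ] ∑[ j < N ] ((w l * Y l j) * z j)
      ≈⟨ sum-cong-≋ {m} (λ l → sum-cong-≋ {N} (λ j → *-assoc (w l) (Y l j) (z j))) ⟩
    ∑[ l < m ] ∑[ j < N ] (w l * (Y l j * z j))
      ≈⟨ sum-cong-≋ {m} (λ l → sym (*-distribˡ-sum (w l) (λ j → Y l j * z j))) ⟩
    ∑[ l < m ] (w l * ∑[ j < N ] (Y l j * z j)) ∎

  signedBinomial : ℕ → ℕ → Carrier
  signedBinomial p l = (p C l) ×′ ((- 1#) ^^ (p ∸ l))

  alternatingBinomialSum : ℕ → (ℕ → Carrier) → Carrier
  alternatingBinomialSum p Y = ∑[ l ≤ p ] (signedBinomial p (toℕ l) * Y (toℕ l))

  alternatingBinomialSum-cong : ∀ p {Y Z : ℕ → Carrier} → (∀ l → Y l ≈ Z l) →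
    alternatingBinomialSum p Y ≈ alternatingBinomialSum p Z
  alternatingBinomialSum-cong p Y≈Z =
    sum-cong-≋ {suc p} (λ l → *-congˡ {signedBinomial p (toℕ l)} (Y≈Z (toℕ l)))

  •≡×′ : ∀ m x → m • x ≡ m ×′ x
  •≡×′ zero    x = P.refl
  •≡×′ (suc m) x = P.cong (x +_) (•≡×′ m x)

  ×′-negate : ∀ m x → m ×′ (- 1# * x) ≈ - (m ×′ x)
  ×′-negate m x = trans (sym (×-comm-* m (- 1#) x)) (-1*x≈-x (m ×′ x))

  signedBinomial-vanishes : ∀ {p l} → p < l → signedBinomial p l ≈ 0#
  signedBinomial-vanishes {p} {l} p<l = reflexive (P.cong (_×′ ((- 1#) ^^ (p ∸ l))) (k>n⇒nCk≡0 p<l))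

  signedBinomial-suc-zero : ∀ p → signedBinomial (suc p) 0 ≈ - signedBinomial p 0
  signedBinomial-suc-zero p = ×′-negate 1 ((- 1#) ^^ p)

  signedBinomial-pascal : ∀ p l →
    signedBinomial (suc p) (suc l) ≈ signedBinomial p l - signedBinomial p (suc l)
  signedBinomial-pascal p l = begin
    (suc p C suc l) ×′ s              ≡⟨ P.cong (_×′ s) (P.sym (nCk+nC[k+1]≡[n+1]C[k+1] p l)) ⟩
    (p C l ℕ.+ p C suc l) ×′ s        ≈⟨ ×-homo-+ s (p C l) (p C suc l) ⟩
    (p C l) ×′ s + (p C suc l) ×′ s   ≈⟨ +-cong refl (flipSign (ℕₚ.<-≤-connex l p)) ⟩
    signedBinomial p l - signedBinomial p (suc l) ∎
    where
    s : Carrier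
    s = (- 1#) ^^ (p ∸ l)

    flipSign : l < p ⊎ p ≤ l → (p C suc l) ×′ s ≈ - signedBinomial p (suc l)
    -- With truncated subtraction, p ∸ l = 1 + (p ∸ suc l) only when l < p; otherwise p C suc l = 0.
    flipSign (inj₁ l<p) = begin
      (p C suc l) ×′ s
        ≡⟨ P.cong (λ e → (p C suc l) ×′ ((- 1#) ^^ e)) (ℕₚ.+-∸-assoc 1 l<p) ⟩
      (p C suc l) ×′ (- 1# * (- 1#) ^^ (p ∸ suc l))
        ≈⟨ ×′-negate (p C suc l) _ ⟩
      - signedBinomial p (suc l) ∎
    flipSign (inj₂ p≤l) = begin
      (p C suc l) ×′ s            ≡⟨ P.cong (_×′ s) (k>n⇒nCk≡0 (s≤s p≤l)) ⟩
      0#                          ≈⟨ sym -0#≈0# ⟩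
      - 0#                        ≈⟨ -‿cong (sym (signedBinomial-vanishes (s≤s p≤l))) ⟩
      - signedBinomial p (suc l)  ∎

  alternatingBinomialSum-extend : ∀ p (Y : ℕ → Carrier) →
    ∑[ l ≤ suc p ] (signedBinomial p (toℕ l) * Y (toℕ l)) ≈ alternatingBinomialSum p Y
  alternatingBinomialSum-extend p Y = begin
    ∑[ l ≤ suc p ] (signedBinomial p (toℕ l) * Y (toℕ l))
      ≈⟨ ∑≤-last p (λ l → signedBinomial p l * Y l) ⟩
    alternatingBinomialSum p Y + signedBinomial p (suc p) * Y (suc p)
      ≈⟨ +-cong refl (trans (*-congʳ (signedBinomial-vanishes (ℕₚ.n<1+n p))) (zeroˡ (Y (suc p)))) ⟩
    alternatingBinomialSum p Y + 0#
      ≈⟨ +-identityʳ _ ⟩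
    alternatingBinomialSum p Y ∎

  alternatingBinomialSum-suc : ∀ p (Y : ℕ → Carrier) →
    alternatingBinomialSum (suc p) Y ≈ alternatingBinomialSum p (Y ∘ suc) - alternatingBinomialSum p Y
  alternatingBinomialSum-suc p Y = begin
    c (suc p) 0 * Y 0 + ∑[ l ≤ p ] (c (suc p) (suc (toℕ l)) * Y (suc (toℕ l)))
      ≈⟨ +-cong (*-congʳ (signedBinomial-suc-zero p)) (sum-cong-≋ {suc p} (pascal ∘ toℕ)) ⟩
    - c p 0 * Y 0 + ∑[ l ≤ p ] (c p (toℕ l) * Y (suc (toℕ l)) - c p (suc (toℕ l)) * Y (suc (toℕ l)))
      ≈⟨ +-cong (sym (-‿distribˡ-* _ _))
                (∑-distrib-- {suc p} (λ l → c p (toℕ l) * Y (suc (toℕ l)))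
                                     (λ l → c p (suc (toℕ l)) * Y (suc (toℕ l)))) ⟩
    - (c p 0 * Y 0) + (A p (Y ∘ suc) - ∑[ l ≤ p ] (c p (suc (toℕ l)) * Y (suc (toℕ l))))
      ≈⟨ x∙yz≈y∙xz _ _ _ ⟩
    A p (Y ∘ suc) + (- (c p 0 * Y 0) - ∑[ l ≤ p ] (c p (suc (toℕ l)) * Y (suc (toℕ l))))
      ≈⟨ +-cong refl (-‿+-comm _ _) ⟩
    A p (Y ∘ suc) - ∑[ l ≤ suc p ] (c p (toℕ l) * Y (toℕ l))
      ≈⟨ +-cong refl (-‿cong (alternatingBinomialSum-extend p Y)) ⟩
    A p (Y ∘ suc) - A p Y ∎
    where
    c : ℕ → ℕ → Carrier
    c = signedBinomial
    A : ℕ → (ℕ → Carrier) → Carrier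
    A = alternatingBinomialSum

    pascal : ∀ l → c (suc p) (suc l) * Y (suc l) ≈ c p l * Y (suc l) - c p (suc l) * Y (suc l)
    pascal l = trans (*-congʳ (signedBinomial-pascal p l)) ([y-z]x≈yx-zx (Y (suc l)) _ _)

  sumL-++ : ∀ xs ys → sumL (xs ++ ys) ≈ sumL xs + sumL ys
  sumL-++ []       ys = sym (+-identityˡ _)
  sumL-++ (x ∷ xs) ys = trans (+-cong refl (sumL-++ xs ys)) (sym (+-assoc _ _ _))

  sumL-concatMap : ∀ {A B : Set} (F : B → Carrier) (h : A → List B) xs →
    sumL (map F (concatMap h xs)) ≈ sumL (map (λ x → sumL (map F (h x))) xs)
  sumL-concatMap F h []       = refl
  sumL-concatMap F h (x ∷ xs) = begin
    sumL (map F (h x ++ concatMap h xs))                ≡⟨ P.cong sumL (map-++ F (h x) (concatMap h xs)) ⟩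
    sumL (map F (h x) ++ map F (concatMap h xs))        ≈⟨ sumL-++ (map F (h x)) _ ⟩
    sumL (map F (h x)) + sumL (map F (concatMap h xs))  ≈⟨ +-cong refl (sumL-concatMap F h xs) ⟩
    sumL (map (λ x → sumL (map F (h x))) (x ∷ xs))      ∎

  sumL-applyUpTo : ∀ {A : Set} (F : A → Carrier) (g : ℕ → A) m →
    sumL (map F (applyUpTo g m)) ≈ ∑[ i < m ] F (g (toℕ i))
  sumL-applyUpTo F g zero    = refl
  sumL-applyUpTo F g (suc m) = +-cong refl (sumL-applyUpTo F (g ∘ suc) m)

  chains-≡[] : ∀ p k n → n < p ℕ.+ k → chains p k n ≡ []
  chains-≡[] zero k n n<k with k ℕ.≟ n
  ... | yes k≡n = ⊥-elim (ℕₚ.<-irrefl (P.sym k≡n) n<k)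
  ... | no _    = P.refl
  chains-≡[] (suc p) k n n<p+k =
    P.trans (concatMap-map (λ j → map (k ∷_) (chains p j n)) (suc k ℕ.+_) (upTo (n ∸ k)))
            (concatMap-≡[] _ (λ i → P.cong (map (k ∷_)) (chains-≡[] p (suc k ℕ.+ i) n (n<p+[1+k+i] i)))
                           (upTo (n ∸ k)))
    where
    n<p+[1+k+i] : ∀ i → n < p ℕ.+ (suc k ℕ.+ i)
    n<p+[1+k+i] i = ℕₚ.≤-trans n<p+k
      (P.subst (_≤ p ℕ.+ (suc k ℕ.+ i)) (ℕₚ.+-suc p k) (ℕₚ.+-monoʳ-≤ p (ℕₚ.m≤m+n (suc k) i)))

  chains-startAt : ∀ p j n → Σ[ cs ∈ List (List ℕ) ] chains p j n ≡ map (j ∷_) cs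
  chains-startAt zero j n with j ℕ.≟ n
  ... | yes _ = [] ∷ [] , P.refl
  ... | no _  = [] , P.refl
  chains-startAt (suc p) j n =
    concatMap (λ i → chains p i n) is , P.sym (map-concatMap (j ∷_) (λ i → chains p i n) is)
    where
    is : List ℕ
    is = map (λ i → suc j ℕ.+ i) (upTo (n ∸ j))

  sumL-chainProd-cons : ∀ ψ k j cs →
    sumL (map (chainProd ψ) (map (k ∷_) (map (j ∷_) cs)))
      ≈ bracket ψ j k * sumL (map (chainProd ψ) (map (j ∷_) cs))
  sumL-chainProd-cons ψ k j []       = sym (zeroʳ _)
  sumL-chainProd-cons ψ k j (c ∷ cs) =
    trans (+-cong refl (sumL-chainProd-cons ψ k j cs)) (sym (distribˡ _ _ _))

  sumL-chainProd-chains : ∀ ψ p k j n →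
    sumL (map (chainProd ψ) (map (k ∷_) (chains p j n)))
      ≈ bracket ψ j k * sumL (map (chainProd ψ) (chains p j n))
  sumL-chainProd-chains ψ p k j n with chains p j n | chains-startAt p j n
  ... | _ | cs , P.refl = sumL-chainProd-cons ψ k j cs

  chainSum-suc : ∀ ψ p k n →
    chainSum ψ n k (suc p) ≈ ∑[ i < n ∸ k ] (bracket ψ (suc k ℕ.+ toℕ i) k * chainSum ψ n (suc k ℕ.+ toℕ i) p)
  chainSum-suc ψ p k n = begin
    sumL (map (chainProd ψ) (concatMap (λ j → map (k ∷_) (chains p j n)) js))
      ≈⟨ sumL-concatMap (chainProd ψ) (λ j → map (k ∷_) (chains p j n)) js ⟩
    sumL (map G js)
      ≡⟨ P.cong sumL (P.sym (map-∘ (upTo (n ∸ k)))) ⟩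
    sumL (map (λ i → G (suc k ℕ.+ i)) (upTo (n ∸ k)))
      ≈⟨ sumL-applyUpTo (λ i → G (suc k ℕ.+ i)) (λ i → i) (n ∸ k) ⟩
    ∑[ i < n ∸ k ] G (suc k ℕ.+ toℕ i)
      ≈⟨ sum-cong-≋ {n ∸ k} (λ i → sumL-chainProd-chains ψ p k (suc k ℕ.+ toℕ i) n) ⟩
    ∑[ i < n ∸ k ] (bracket ψ (suc k ℕ.+ toℕ i) k * chainSum ψ n (suc k ℕ.+ toℕ i) p) ∎
    where
    js : List ℕ
    js = map (λ i → suc k ℕ.+ i) (upTo (n ∸ k))
    G : ℕ → Carrier
    G j = sumL (map (chainProd ψ) (map (k ∷_) (chains p j n)))

  chainSum-vanishes : ∀ ψ p k n → n < p ℕ.+ k → chainSum ψ n k p ≈ 0#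
  chainSum-vanishes ψ p k n n<p+k = reflexive (P.cong (sumL ∘ map (chainProd ψ)) (chains-≡[] p k n n<p+k))

  coeff-⊕ : ∀ p q k → coeff (p ⊕ q) k ≈ coeff p k + coeff q k
  coeff-⊕ []      q       k       = sym (+-identityˡ _)
  coeff-⊕ (a ∷ p) []      k       = sym (+-identityʳ _)
  coeff-⊕ (a ∷ p) (b ∷ q) zero    = refl
  coeff-⊕ (a ∷ p) (b ∷ q) (suc k) = coeff-⊕ p q k

  coeff-scale : ∀ a p k → coeff (scale a p) k ≈ a * coeff p k
  coeff-scale a []      k       = sym (zeroʳ a)
  coeff-scale a (b ∷ p) zero    = refl
  coeff-scale a (b ∷ p) (suc k) = coeff-scale a p k

  coeff-scale-⊕ : ∀ a p q k → coeff (scale a p ⊕ q) k ≈ a * coeff p k + coeff q k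
  coeff-scale-⊕ a p q k = trans (coeff-⊕ (scale a p) q k) (+-cong (coeff-scale a p k) refl)

  coeff-negP : ∀ p k → coeff (negP p) k ≈ - coeff p k
  coeff-negP []      k       = sym -0#≈0#
  coeff-negP (b ∷ p) zero    = refl
  coeff-negP (b ∷ p) (suc k) = coeff-negP p k

  coeff-≥length : ∀ q j → length q ≤ j → coeff q j ≡ 0#
  coeff-≥length []      j       _         = P.refl
  coeff-≥length (a ∷ q) (suc j) (s≤s q≤j) = coeff-≥length q j q≤j

  coeff-xpow-≡ : ∀ n → coeff (xpow n) n ≡ 1#
  coeff-xpow-≡ zero    = P.refl
  coeff-xpow-≡ (suc n) = coeff-xpow-≡ n

  coeff-xpow-≢ : ∀ n k → k ≢ n → coeff (xpow n) k ≡ 0#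
  coeff-xpow-≢ zero    zero    k≢n = ⊥-elim (k≢n P.refl)
  coeff-xpow-≢ zero    (suc k) _   = P.refl
  coeff-xpow-≢ (suc n) zero    _   = P.refl
  coeff-xpow-≢ (suc n) (suc k) k≢n = coeff-xpow-≢ n k (k≢n ∘ P.cong suc)

  xpow-degExactly : ¬ (1# ≈ 0#) → ∀ n → DegExactly n (xpow n)
  xpow-degExactly 1≉0 n =
    (λ xⁿₙ≈0 → 1≉0 (trans (reflexive (P.sym (coeff-xpow-≡ n))) xⁿₙ≈0)) ,
    (λ k n<k → reflexive (coeff-xpow-≢ n k (ℕₚ.>⇒≢ n<k)))

  coeff-applyFrom : ∀ U i q N k → (∀ j → N ≤ j → coeff q j ≈ 0#) →
    coeff (applyFrom U i q) k ≈ ∑[ j < N ] (coeff q (toℕ j) * coeff (U (i ℕ.+ toℕ j)) k)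
  coeff-applyFrom U i [] N k _ = sym (∑-≈0 {N} (λ j → zeroˡ _))
  coeff-applyFrom U i (a ∷ q) zero k q≈0 = begin
    coeff (scale a (U i) ⊕ applyFrom U (suc i) q) k
      ≈⟨ coeff-scale-⊕ a (U i) _ k ⟩
    a * coeff (U i) k + coeff (applyFrom U (suc i) q) k
      ≈⟨ +-cong (trans (*-congʳ (q≈0 0 z≤n)) (zeroˡ _))
                (coeff-applyFrom U (suc i) q zero k (λ j _ → q≈0 (suc j) z≤n)) ⟩
    0# + 0#
      ≈⟨ +-identityˡ 0# ⟩
    0# ∎
  coeff-applyFrom U i (a ∷ q) (suc N) k q≈0 = begin
    coeff (scale a (U i) ⊕ applyFrom U (suc i) q) k
      ≈⟨ coeff-scale-⊕ a (U i) _ k ⟩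
    a * coeff (U i) k + coeff (applyFrom U (suc i) q) k
      ≈⟨ +-cong refl (coeff-applyFrom U (suc i) q N k (λ j N≤j → q≈0 (suc j) (s≤s N≤j))) ⟩
    a * coeff (U i) k + ∑[ j < N ] (coeff q (toℕ j) * coeff (U (suc i ℕ.+ toℕ j)) k)
      ≡⟨ P.cong₂ _+_ (P.cong (λ m → a * coeff (U m) k) (P.sym (ℕₚ.+-identityʳ i)))
                     (sum-cong-≗ {N} (λ j → P.cong (λ m → coeff q (toℕ j) * coeff (U m) k)
                                                   (P.sym (ℕₚ.+-suc i (toℕ j))))) ⟩
    a * coeff (U (i ℕ.+ 0)) k + ∑[ j < N ] (coeff q (toℕ j) * coeff (U (i ℕ.+ suc (toℕ j))) k) ∎

  coeff-apply : ∀ U q N k → (∀ j → N ≤ j → coeff q j ≈ 0#) →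
    coeff (apply U q) k ≈ ∑[ j < N ] (coeff q (toℕ j) * coeff (U (toℕ j)) k)
  coeff-apply U = coeff-applyFrom U 0

  coeff-applyFrom-xpow : ∀ U i n k → coeff (applyFrom U i (xpow n)) k ≈ coeff (U (i ℕ.+ n)) k
  coeff-applyFrom-xpow U i zero k = begin
    coeff (scale 1# (U i) ⊕ []) k  ≈⟨ coeff-scale-⊕ 1# (U i) [] k ⟩
    1# * coeff (U i) k + 0#        ≈⟨ +-identityʳ _ ⟩
    1# * coeff (U i) k             ≈⟨ *-identityˡ _ ⟩
    coeff (U i) k                  ≡⟨ P.cong (λ m → coeff (U m) k) (P.sym (ℕₚ.+-identityʳ i)) ⟩
    coeff (U (i ℕ.+ 0)) k          ∎
  coeff-applyFrom-xpow U i (suc n) k = begin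
    coeff (scale 0# (U i) ⊕ applyFrom U (suc i) (xpow n)) k
      ≈⟨ coeff-scale-⊕ 0# (U i) _ k ⟩
    0# * coeff (U i) k + coeff (applyFrom U (suc i) (xpow n)) k
      ≈⟨ +-cong (zeroˡ _) (coeff-applyFrom-xpow U (suc i) n k) ⟩
    0# + coeff (U (suc i ℕ.+ n)) k
      ≈⟨ +-identityˡ _ ⟩
    coeff (U (suc i ℕ.+ n)) k
      ≡⟨ P.cong (λ m → coeff (U m) k) (P.sym (ℕₚ.+-suc i n)) ⟩
    coeff (U (i ℕ.+ suc n)) k ∎

  bracket≈coeff : ∀ U n k → bracket U n k ≈ coeff (U n) k
  bracket≈coeff U = coeff-applyFrom-xpow U 0

  ∑-coeff-xpow : ∀ N k (x : ℕ → Carrier) → k < N →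
    ∑[ j < N ] (x (toℕ j) * coeff (xpow (toℕ j)) k) ≈ x k
  ∑-coeff-xpow (suc N) zero x _ =
    trans (+-cong (*-identityʳ (x 0)) (∑-≈0 {N} (λ j → zeroʳ (x (suc (toℕ j)))))) (+-identityʳ (x 0))
  ∑-coeff-xpow (suc N) (suc k) x (s≤s k<N) =
    trans (+-cong (zeroʳ (x 0)) (∑-coeff-xpow N k (x ∘ suc) k<N)) (+-identityˡ (x (suc k)))

  coeff-apply-idOp : ∀ q k → coeff (apply idOp q) k ≈ coeff q k
  coeff-apply-idOp q k = begin
    coeff (apply idOp q) k
      ≈⟨ coeff-apply idOp q N k q≈0 ⟩
    ∑[ j < N ] (coeff q (toℕ j) * coeff (xpow (toℕ j)) k)
      ≈⟨ ∑-coeff-xpow N k (coeff q) (ℕₚ.m≤n+m (suc k) (length q)) ⟩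
    coeff q k ∎
    where
    N : ℕ
    N = length q ℕ.+ suc k
    q≈0 : ∀ j → N ≤ j → coeff q j ≈ 0#
    q≈0 j N≤j = reflexive (coeff-≥length q j (ℕₚ.≤-trans (ℕₚ.m≤m+n (length q) (suc k)) N≤j))

  [x-y]+[z-w]≈[x+z]-[y+w] : ∀ x y z w → (x - y) + (z - w) ≈ (x + z) - (y + w)
  [x-y]+[z-w]≈[x+z]-[y+w] x y z w = trans (interchange x (- y) z (- w)) (+-cong refl (-‿+-comm y w))

  coeff-−ₒ : ∀ U W n k → coeff ((U -ₒ W) n) k ≈ coeff (U n) k - coeff (W n) k
  coeff-−ₒ U W n k = trans (coeff-⊕ (U n) (negP (W n)) k) (+-cong refl (coeff-negP (W n) k))

  coeff-applyFrom-−ₒ : ∀ U W i q k →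
    coeff (applyFrom (U -ₒ W) i q) k ≈ coeff (applyFrom U i q) k - coeff (applyFrom W i q) k
  coeff-applyFrom-−ₒ U W i []      k = sym (-‿inverseʳ 0#)
  coeff-applyFrom-−ₒ U W i (a ∷ q) k = begin
    coeff (scale a ((U -ₒ W) i) ⊕ applyFrom (U -ₒ W) (suc i) q) k
      ≈⟨ coeff-scale-⊕ a ((U -ₒ W) i) _ k ⟩
    a * coeff ((U -ₒ W) i) k + coeff (applyFrom (U -ₒ W) (suc i) q) k
      ≈⟨ +-cong (trans (*-congˡ (coeff-−ₒ U W i k)) (x[y-z]≈xy-xz a _ _)) (coeff-applyFrom-−ₒ U W (suc i) q k) ⟩
    (a * Uᵢ - a * Wᵢ) + (coeff (applyFrom U (suc i) q) k - coeff (applyFrom W (suc i) q) k)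
      ≈⟨ [x-y]+[z-w]≈[x+z]-[y+w] _ _ _ _ ⟩
    (a * Uᵢ + coeff (applyFrom U (suc i) q) k) - (a * Wᵢ + coeff (applyFrom W (suc i) q) k)
      ≈⟨ sym (+-cong (coeff-scale-⊕ a (U i) _ k) (-‿cong (coeff-scale-⊕ a (W i) _ k))) ⟩
    coeff (scale a (U i) ⊕ applyFrom U (suc i) q) k - coeff (scale a (W i) ⊕ applyFrom W (suc i) q) k ∎
    where
    Uᵢ Wᵢ : Carrier
    Uᵢ = coeff (U i) k
    Wᵢ = coeff (W i) k

  coeff-−ₒ-∘ₒ : ∀ U W V n k →
    coeff (((U -ₒ W) ∘ₒ V) n) k ≈ coeff ((U ∘ₒ V) n) k - coeff ((W ∘ₒ V) n) k
  coeff-−ₒ-∘ₒ U W V n = coeff-applyFrom-−ₒ U W 0 (V n)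

  LowerTriangular : Op → Set ℓ
  LowerTriangular U = ∀ n k → n < k → coeff (U n) k ≈ 0#

  StrictlyLowerTriangular : Op → Set ℓ
  StrictlyLowerTriangular U = ∀ n k → n ≤ k → coeff (U n) k ≈ 0#

  coeff-∘ₒ : ∀ U V → LowerTriangular V → ∀ n k →
    coeff ((U ∘ₒ V) n) k ≈ ∑[ j ≤ n ] (coeff (V n) (toℕ j) * coeff (U (toℕ j)) k)
  coeff-∘ₒ U V V-lower n k = coeff-apply U (V n) (suc n) k (V-lower n)

  idOp-lowerTriangular : LowerTriangular idOp
  idOp-lowerTriangular n k n<k = reflexive (coeff-xpow-≢ n k (ℕₚ.>⇒≢ n<k))

  −ₒ-lowerTriangular : ∀ U W → LowerTriangular U → LowerTriangular W → LowerTriangular (U -ₒ W)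
  −ₒ-lowerTriangular U W U-lower W-lower n k n<k = begin
    coeff ((U -ₒ W) n) k           ≈⟨ coeff-−ₒ U W n k ⟩
    coeff (U n) k - coeff (W n) k  ≈⟨ +-cong (U-lower n k n<k) (-‿cong (W-lower n k n<k)) ⟩
    0# - 0#                        ≈⟨ -‿inverseʳ 0# ⟩
    0#                             ∎

  ∘ₒ-lowerTriangular : ∀ U V → LowerTriangular U → LowerTriangular V → LowerTriangular (U ∘ₒ V)
  ∘ₒ-lowerTriangular U V U-lower V-lower n k n<k =
    trans (coeff-∘ₒ U V V-lower n k) (∑-≈0 {suc n} term≈0)
    where
    term≈0 : ∀ (j : Fin (suc n)) → coeff (V n) (toℕ j) * coeff (U (toℕ j)) k ≈ 0#
    term≈0 j = trans (*-congˡ (U-lower (toℕ j) k (ℕₚ.≤-<-trans (toℕ≤pred[n] j) n<k))) (zeroʳ _)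

  ^ₒ-lowerTriangular : ∀ U → LowerTriangular U → ∀ l → LowerTriangular (U ^ₒ l)
  ^ₒ-lowerTriangular U U-lower zero    = idOp-lowerTriangular
  ^ₒ-lowerTriangular U U-lower (suc l) =
    ∘ₒ-lowerTriangular U (U ^ₒ l) U-lower (^ₒ-lowerTriangular U U-lower l)

  degreePreserving⇒lowerTriangular : ¬ (1# ≈ 0#) → ∀ ψ → DegreePreserving ψ → LowerTriangular ψ
  degreePreserving⇒lowerTriangular 1≉0 ψ ψ-degree n k n<k =
    trans (sym (bracket≈coeff ψ n k)) (proj₂ (ψ-degree n (xpow n) (xpow-degExactly 1≉0 n)) k n<k)

  coeff-−ₒidOp-offDiagonal : ∀ U j k → k ≢ j → coeff ((U -ₒ idOp) j) k ≈ coeff (U j) k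
  coeff-−ₒidOp-offDiagonal U j k k≢j = begin
    coeff ((U -ₒ idOp) j) k           ≈⟨ coeff-−ₒ U idOp j k ⟩
    coeff (U j) k - coeff (xpow j) k  ≈⟨ +-cong refl (-‿cong (reflexive (coeff-xpow-≢ j k k≢j))) ⟩
    coeff (U j) k - 0#                ≈⟨ +-cong refl -0#≈0# ⟩
    coeff (U j) k + 0#                ≈⟨ +-identityʳ _ ⟩
    coeff (U j) k                     ∎

  unitary⇒strictlyLowerTriangular : ∀ ψ → LowerTriangular ψ → Unitary ψ →
    StrictlyLowerTriangular (ψ -ₒ idOp)
  unitary⇒strictlyLowerTriangular ψ ψ-lower ψ-unitary n k n≤k with ℕₚ.m≤n⇒m<n∨m≡n n≤k
  ... | inj₁ n<k    = −ₒ-lowerTriangular ψ idOp ψ-lower idOp-lowerTriangular n k n<k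
  ... | inj₂ P.refl = begin
    coeff ((ψ -ₒ idOp) n) n
      ≈⟨ coeff-−ₒ ψ idOp n n ⟩
    coeff (ψ n) n - coeff (xpow n) n
      ≈⟨ +-cong (trans (sym (bracket≈coeff ψ n n)) (ψ-unitary n)) (-‿cong (reflexive (coeff-xpow-≡ n))) ⟩
    1# - 1#
      ≈⟨ -‿inverseʳ 1# ⟩
    0# ∎

  [ψ-1]^p-lowerTriangular : ∀ ψ → LowerTriangular ψ → ∀ p → LowerTriangular ((ψ -ₒ idOp) ^ₒ p)
  [ψ-1]^p-lowerTriangular ψ ψ-lower =
    ^ₒ-lowerTriangular (ψ -ₒ idOp) (−ₒ-lowerTriangular ψ idOp ψ-lower idOp-lowerTriangular)

  coeff-[ψ-1]^p≈alternatingBinomialSum : ∀ ψ → LowerTriangular ψ → ∀ p n k →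
    coeff (((ψ -ₒ idOp) ^ₒ p) n) k ≈ alternatingBinomialSum p (λ l → coeff ((ψ ^ₒ l) n) k)
  coeff-[ψ-1]^p≈alternatingBinomialSum ψ ψ-lower zero n k = sym (begin
    (1# + 0#) * coeff (xpow n) k + 0#  ≈⟨ +-identityʳ _ ⟩
    (1# + 0#) * coeff (xpow n) k       ≈⟨ *-congʳ (+-identityʳ 1#) ⟩
    1# * coeff (xpow n) k              ≈⟨ *-identityˡ _ ⟩
    coeff (xpow n) k                   ∎)
  coeff-[ψ-1]^p≈alternatingBinomialSum ψ ψ-lower (suc p) n k = begin
    coeff (((ψ -ₒ idOp) ∘ₒ Tᵖ) n) k
      ≈⟨ coeff-−ₒ-∘ₒ ψ idOp Tᵖ n k ⟩
    coeff ((ψ ∘ₒ Tᵖ) n) k - coeff ((idOp ∘ₒ Tᵖ) n) k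
      ≈⟨ +-cong coeff-ψ∘ₒTᵖ (-‿cong (trans (coeff-apply-idOp (Tᵖ n) k) (IH k))) ⟩
    A p (Y ∘ suc) - A p Y
      ≈⟨ alternatingBinomialSum-suc p Y ⟨
    A (suc p) Y ∎
    where
    A : ℕ → (ℕ → Carrier) → Carrier
    A = alternatingBinomialSum
    Tᵖ : Op
    Tᵖ = (ψ -ₒ idOp) ^ₒ p
    Y : ℕ → Carrier
    Y l = coeff ((ψ ^ₒ l) n) k
    IH : ∀ j → coeff (Tᵖ n) j ≈ A p (λ l → coeff ((ψ ^ₒ l) n) j)
    IH = coeff-[ψ-1]^p≈alternatingBinomialSum ψ ψ-lower p n

    coeff-ψ∘ₒTᵖ : coeff ((ψ ∘ₒ Tᵖ) n) k ≈ A p (Y ∘ suc)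
    coeff-ψ∘ₒTᵖ = begin
      coeff ((ψ ∘ₒ Tᵖ) n) k
        ≈⟨ coeff-∘ₒ ψ Tᵖ ([ψ-1]^p-lowerTriangular ψ ψ-lower p) n k ⟩
      ∑[ j ≤ n ] (coeff (Tᵖ n) (toℕ j) * coeff (ψ (toℕ j)) k)
        ≈⟨ sum-cong-≋ {suc n} (λ j → *-congʳ {coeff (ψ (toℕ j)) k} (IH (toℕ j))) ⟩
      ∑[ j ≤ n ] (A p (λ l → coeff ((ψ ^ₒ l) n) (toℕ j)) * coeff (ψ (toℕ j)) k)
        ≈⟨ ∑∑-*-assoc {suc p} {suc n} (λ l → signedBinomial p (toℕ l))
                                     (λ l j → coeff ((ψ ^ₒ toℕ l) n) (toℕ j)) (λ j → coeff (ψ (toℕ j)) k) ⟩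
      A p (λ l → ∑[ j ≤ n ] (coeff ((ψ ^ₒ l) n) (toℕ j) * coeff (ψ (toℕ j)) k))
        ≈⟨ alternatingBinomialSum-cong p (λ l → coeff-∘ₒ ψ (ψ ^ₒ l) (^ₒ-lowerTriangular ψ ψ-lower l) n k) ⟨
      A p (Y ∘ suc) ∎

  coeff-[ψ-1]^p≈chainSum : ∀ ψ → LowerTriangular ψ → Unitary ψ → ∀ p n k →
    coeff (((ψ -ₒ idOp) ^ₒ p) n) k ≈ chainSum ψ n k p
  coeff-[ψ-1]^p≈chainSum ψ ψ-lower ψ-unitary zero n k with k ℕ.≟ n
  ... | yes P.refl = trans (reflexive (coeff-xpow-≡ k)) (sym (+-identityʳ 1#))
  ... | no k≢n     = reflexive (coeff-xpow-≢ n k k≢n)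
  coeff-[ψ-1]^p≈chainSum ψ ψ-lower ψ-unitary (suc p) n k = begin
    coeff (((ψ -ₒ idOp) ∘ₒ Tᵖ) n) k
      ≈⟨ coeff-∘ₒ (ψ -ₒ idOp) Tᵖ ([ψ-1]^p-lowerTriangular ψ ψ-lower p) n k ⟩
    ∑[ j ≤ n ] (coeff (Tᵖ n) (toℕ j) * coeff ((ψ -ₒ idOp) (toℕ j)) k)
      ≈⟨ sum-cong-≋ {suc n} (λ j → *-congʳ {coeff ((ψ -ₒ idOp) (toℕ j)) k} (IH (toℕ j))) ⟩
    ∑[ j ≤ n ] f (toℕ j)
      ≈⟨ ∑-dropLeadingZeros (suc k) (suc n) f f≈0 ⟩
    ∑[ i < n ∸ k ] f (suc k ℕ.+ toℕ i)
      ≈⟨ sum-cong-≋ {n ∸ k} (λ i → trans (*-congˡ (coeff-[ψ-1]-below (suc k ℕ.+ toℕ i) (k<1+k+i (toℕ i))))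
                                         (*-comm _ _)) ⟩
    ∑[ i < n ∸ k ] (bracket ψ (suc k ℕ.+ toℕ i) k * chainSum ψ n (suc k ℕ.+ toℕ i) p)
      ≈⟨ chainSum-suc ψ p k n ⟨
    chainSum ψ n k (suc p) ∎
    where
    Tᵖ : Op
    Tᵖ = (ψ -ₒ idOp) ^ₒ p
    IH : ∀ j → coeff (Tᵖ n) j ≈ chainSum ψ n j p
    IH = coeff-[ψ-1]^p≈chainSum ψ ψ-lower ψ-unitary p n

    f : ℕ → Carrier
    f j = chainSum ψ n j p * coeff ((ψ -ₒ idOp) j) k

    f≈0 : ∀ j → j < suc k → f j ≈ 0#
    f≈0 j j<1+k =
      trans (*-congˡ (unitary⇒strictlyLowerTriangular ψ ψ-lower ψ-unitary j k (ℕₚ.≤-pred j<1+k))) (zeroʳ _)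

    k<1+k+i : ∀ i → k < suc k ℕ.+ i
    k<1+k+i i = s≤s (ℕₚ.m≤m+n k i)

    coeff-[ψ-1]-below : ∀ j → k < j → coeff ((ψ -ₒ idOp) j) k ≈ bracket ψ j k
    coeff-[ψ-1]-below j k<j =
      trans (coeff-−ₒidOp-offDiagonal ψ j k (ℕₚ.<⇒≢ k<j)) (sym (bracket≈coeff ψ j k))

  binomSum≈alternatingBinomialSum : ∀ ψ n k p →
    binomSum ψ n k p ≈ alternatingBinomialSum p (λ l → bracket (ψ ^ₒ l) n k)
  binomSum≈alternatingBinomialSum ψ n k p =
    trans (sumL-applyUpTo F (λ l → l) (suc p)) (sum-cong-≋ {suc p} (term ∘ toℕ))
    where
    F : ℕ → Carrier
    F l = (p C l) • (((- 1#) ^^ (p ∸ l)) * bracket (ψ ^ₒ l) n k)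
    term : ∀ l → F l ≈ signedBinomial p l * bracket (ψ ^ₒ l) n k
    term l = trans (reflexive (•≡×′ (p C l) _))
                   (sym (×-assoc-* (p C l) ((- 1#) ^^ (p ∸ l)) (bracket (ψ ^ₒ l) n k)))

  binomSum≈bracket[ψ-1]^p : ∀ ψ → LowerTriangular ψ → ∀ n k p →
    binomSum ψ n k p ≈ bracket ((ψ -ₒ idOp) ^ₒ p) n k
  binomSum≈bracket[ψ-1]^p ψ ψ-lower n k p = begin
    binomSum ψ n k p
      ≈⟨ binomSum≈alternatingBinomialSum ψ n k p ⟩
    alternatingBinomialSum p (λ l → bracket (ψ ^ₒ l) n k)
      ≈⟨ alternatingBinomialSum-cong p (λ l → bracket≈coeff (ψ ^ₒ l) n k) ⟩
    alternatingBinomialSum p (λ l → coeff ((ψ ^ₒ l) n) k)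
      ≈⟨ coeff-[ψ-1]^p≈alternatingBinomialSum ψ ψ-lower p n k ⟨
    coeff (((ψ -ₒ idOp) ^ₒ p) n) k
      ≈⟨ bracket≈coeff ((ψ -ₒ idOp) ^ₒ p) n k ⟨
    bracket ((ψ -ₒ idOp) ^ₒ p) n k ∎

  bracket[ψ-1]^p≈chainSum : ∀ ψ → LowerTriangular ψ → Unitary ψ → ∀ n k p →
    bracket ((ψ -ₒ idOp) ^ₒ p) n k ≈ chainSum ψ n k p
  bracket[ψ-1]^p≈chainSum ψ ψ-lower ψ-unitary n k p =
    trans (bracket≈coeff ((ψ -ₒ idOp) ^ₒ p) n k) (coeff-[ψ-1]^p≈chainSum ψ ψ-lower ψ-unitary p n k)

mainTheorem2 : ∀ {c ℓ} (K : CommutativeRing c ℓ) →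
    let open CommutativeRing K
        open Poly K
    in IsField → CharZero →
       (ψ : Op) → Invertible ψ → DegreePreserving ψ → Unitary ψ →
       (n k p : ℕ) →
         (binomSum ψ n k p ≈ bracket ((ψ -ₒ idOp) ^ₒ p) n k)
       × (bracket ((ψ -ₒ idOp) ^ₒ p) n k ≈ chainSum ψ n k p)
       × (n ℕ.< p ℕ.+ k → bracket ((ψ -ₒ idOp) ^ₒ p) n k ≈ 0#)
mainTheorem2 K K-field _ ψ _ ψ-degree ψ-unitary n k p =
    binomSum≈bracket[ψ-1]^p K ψ ψ-lower n k p
  , bracket[ψ-1]^p≈chainSum K ψ ψ-lower ψ-unitary n k p
  , λ n<p+k → CommutativeRing.trans K (bracket[ψ-1]^p≈chainSum K ψ ψ-lower ψ-unitary n k p)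
                                      (chainSum-vanishes K ψ p k n n<p+k)
  where
  ψ-lower : LowerTriangular K ψ
  ψ-lower = degreePreserving⇒lowerTriangular K (Poly.IsField.nontrivial K-field) ψ ψ-degree
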